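{- Let $G$ be a cubic graph and let $J_1,J_2,J_3$ be three joins of $G$. For $i\in\{0,1,2,3\}$ let $E_i$ be the set of edges of $G$ contained in exactly $i$ of the sets $J_1,J_2,J_3$, and for each $j$ let $n(J_j)$ be the number of $J_j$-vertices. Then $$|E_0|+\sum_{j=1}^3 n(J_j)=|E_2|+2|E_3|.$$
   Context: A join of a graph $H$ is a set $J\subseteq E(H)$ such that every vertex has degrees of the same parity in $H$ and in the spanning subgraph with edge set $J$. In a cubic graph every vertex therefore has degree $1$ or $3$ in $J$; a vertex of degree $3$ in $J$ is called a $J$-vertex. -}

module Defs where

open import Data.Nat using (ℕ; _+_; _%_)
open import Data.Nat.Properties using (_≟_)
open import Data.Fin using (Fin)
import Data.Fin.Properties as FinP
open import Data.Fin.Subset using (Subset; ⊤)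
open import Data.Fin.Subset.Properties using (_∈?_)
open import Data.List using (List; map; allFin)
open import Data.Nat.ListAction using (sum)
open import Data.Product using (_×_; proj₁; proj₂)
open import Relation.Binary.PropositionalEquality using (_≡_; _≢_)
open import Relation.Nullary using (Dec; does)
open import Data.Bool using (if_then_else_)

-- Finite multigraph (parallel edges allowed, no loops):
-- vertices Fin n, edges Fin m, each edge has two distinct ends.
record Graph : Set where
  field
    n : ℕ
    m : ℕ
    ends : Fin m → Fin n × Fin n
    loopless : ∀ e → proj₁ (ends e) ≢ proj₂ (ends e)

open Graph public

Σfin : ∀ k → (Fin k → ℕ) → ℕ
Σfin k f = sum (map f (allFin k))

⟦_⟧ : ∀ {P : Set} → Dec P → ℕ
⟦ d ⟧ = if does d then 1 else 0

-- Number of ends of edge e at vertex v (0, 1; 2 impossible since loopless).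
incidence : (G : Graph) → Fin (m G) → Fin (n G) → ℕ
incidence G e v = ⟦ FinP._≟_ (proj₁ (ends G e)) v ⟧ + ⟦ FinP._≟_ (proj₂ (ends G e)) v ⟧

deg : (G : Graph) → Subset (m G) → Fin (n G) → ℕ
deg G S v = Σfin (m G) (λ e → ⟦ e ∈? S ⟧ * incidence G e v)
  where open Data.Nat using (_*_)

degG : (G : Graph) → Fin (n G) → ℕ
degG G = deg G ⊤

Cubic : Graph → Set
Cubic G = ∀ v → degG G v ≡ 3

IsJoin : (G : Graph) → Subset (m G) → Set
IsJoin G J = ∀ v → deg G J v % 2 ≡ degG G v % 2

nJ : (G : Graph) → Subset (m G) → ℕ
nJ G J = Σfin (n G) (λ v → ⟦ deg G J v ≟ 3 ⟧)

mult : (G : Graph) → Subset (m G) → Subset (m G) → Subset (m G) → Fin (m G) → ℕ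
mult G J₁ J₂ J₃ e = ⟦ e ∈? J₁ ⟧ + ⟦ e ∈? J₂ ⟧ + ⟦ e ∈? J₃ ⟧

cardE : (G : Graph) → Subset (m G) → Subset (m G) → Subset (m G) → ℕ → ℕ
cardE G J₁ J₂ J₃ i = Σfin (m G) (λ e → ⟦ mult G J₁ J₂ J₃ e ≟ i ⟧)

-- By the handshake lemma, 2|J| is the sum of the J-degrees; in a cubic
-- graph a join has degree 1 or 3 at every vertex, so 2|J| = |V| + 2 n(J), and 2|E| = 3|V|.
-- Adding this over the three joins gives |J₁| + |J₂| + |J₃| = |E| + Σ n(Jⱼ). On the other
-- hand, counting each edge by its multiplicity, |J₁| + |J₂| + |J₃| = |E₁| + 2|E₂| + 3|E₃|,
-- while |E| = |E₀| + |E₁| + |E₂| + |E₃|; comparing the two expressions gives the identity.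
module Submission where

open import Defs
open import Data.Nat using (ℕ; zero; suc; _+_; _*_; _%_; _≤_; z≤n; s≤s)
open import Data.Nat.Properties
  using (+-*-semiring; _≟_; *-comm; *-identityʳ; *-zeroʳ; +-assoc; +-comm; +-mono-≤; *-monoˡ-≤
        ; +-cancelʳ-≡; *-cancelˡ-≡)
open import Data.Nat.Tactic.RingSolver using (solve-∀)
open import Data.Fin using (Fin; zero; suc)
import Data.Fin.Properties as Fin
open import Data.Fin.Subset using (Subset; ⊤)
open import Data.Fin.Subset.Properties using (_∈?_)
open import Data.List using (map; tabulate)
import Data.Nat.ListAction as List
open import Data.Product using (proj₁; proj₂)
open import Function using (id; _∘_)
open import Relation.Nullary using (Dec; yes; no)
open import Relation.Binary.PropositionalEquality
open import Algebra.Properties.Semiring.Sum +-*-semiring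
  using (sum-syntax; sum-cong-≗; ∑-distrib-+; ∑-comm; *-distribˡ-sum; *-distribʳ-sum)

sum-map-tabulate : ∀ {A : Set} k (f : A → ℕ) (g : Fin k → A)
  → List.sum (map f (tabulate g)) ≡ ∑[ i < k ] f (g i)
sum-map-tabulate zero    f g = refl
sum-map-tabulate (suc k) f g = cong (f (g zero) +_) (sum-map-tabulate k f (g ∘ suc))

Σfin≡∑ : ∀ k (f : Fin k → ℕ) → Σfin k f ≡ ∑[ i < k ] f i
Σfin≡∑ k f = sum-map-tabulate k f id

∑-const : ∀ k c → ∑[ i < k ] c ≡ k * c
∑-const zero    c = refl
∑-const (suc k) c = cong (c +_) (∑-const k c)

∑-mono-≤ : ∀ {k} {f g : Fin k → ℕ} → (∀ i → f i ≤ g i) → ∑[ i < k ] f i ≤ ∑[ i < k ] g i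
∑-mono-≤ {zero}  f≤g = z≤n
∑-mono-≤ {suc k} f≤g = +-mono-≤ (f≤g zero) (∑-mono-≤ (f≤g ∘ suc))

⟦⟧≤1 : ∀ {P : Set} (d : Dec P) → ⟦ d ⟧ ≤ 1
⟦⟧≤1 (yes _) = s≤s z≤n
⟦⟧≤1 (no _)  = z≤n

∑-⟦≟⟧ : ∀ {k} (a : Fin k) → ∑[ v < k ] ⟦ a Fin.≟ v ⟧ ≡ 1
∑-⟦≟⟧ {suc k} zero    = cong suc (trans (∑-const k 0) (*-zeroʳ k))
∑-⟦≟⟧ {suc k} (suc a) = ∑-⟦≟⟧ a  -- ⟦ suc a ≟ zero ⟧ ⇒ 0 and ⟦ suc a ≟ suc v ⟧ ⇒ ⟦ a ≟ v ⟧

card : ∀ {k} → Subset k → ℕ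
card {k} S = ∑[ e < k ] ⟦ e ∈? S ⟧

⟦∈⊤⟧ : ∀ {k} (e : Fin k) → ⟦ e ∈? ⊤ ⟧ ≡ 1
⟦∈⊤⟧ zero    = refl
⟦∈⊤⟧ (suc e) = ⟦∈⊤⟧ e

card-⊤ : ∀ k → card (⊤ {k}) ≡ k
card-⊤ zero    = refl
card-⊤ (suc k) = cong suc (card-⊤ k)

∑-incidence : ∀ G e → ∑[ v < n G ] incidence G e v ≡ 2
∑-incidence G e = begin
  ∑[ v < n G ] incidence G e v
    ≡⟨ ∑-distrib-+ (λ v → ⟦ proj₁ (ends G e) Fin.≟ v ⟧) (λ v → ⟦ proj₂ (ends G e) Fin.≟ v ⟧) ⟩
  ∑[ v < n G ] ⟦ proj₁ (ends G e) Fin.≟ v ⟧ + ∑[ v < n G ] ⟦ proj₂ (ends G e) Fin.≟ v ⟧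
    ≡⟨ cong₂ _+_ (∑-⟦≟⟧ (proj₁ (ends G e))) (∑-⟦≟⟧ (proj₂ (ends G e))) ⟩
  2 ∎
  where open ≡-Reasoning

handshake : ∀ G (S : Subset (m G)) → ∑[ v < n G ] deg G S v ≡ 2 * card S
handshake G S = begin
  ∑[ v < n G ] deg G S v
    ≡⟨ sum-cong-≗ (λ v → Σfin≡∑ (m G) (λ e → ∈S e * incidence G e v)) ⟩
  ∑[ v < n G ] ∑[ e < m G ] (∈S e * incidence G e v)
    ≡⟨ ∑-comm (λ v e → ∈S e * incidence G e v) ⟩
  ∑[ e < m G ] ∑[ v < n G ] (∈S e * incidence G e v)
    ≡⟨ sum-cong-≗ (λ e → sym (*-distribˡ-sum (∈S e) (incidence G e))) ⟩
  ∑[ e < m G ] (∈S e * ∑[ v < n G ] incidence G e v)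
    ≡⟨ sum-cong-≗ (λ e → cong (∈S e *_) (∑-incidence G e)) ⟩
  ∑[ e < m G ] (∈S e * 2)
    ≡⟨ sym (*-distribʳ-sum 2 ∈S) ⟩
  card S * 2
    ≡⟨ *-comm (card S) 2 ⟩
  2 * card S ∎
  where
  open ≡-Reasoning
  ∈S : Fin (m G) → ℕ
  ∈S e = ⟦ e ∈? S ⟧

deg≤degG : ∀ G S v → deg G S v ≤ degG G v
deg≤degG G S v = subst₂ _≤_ (sym (Σfin≡∑ (m G) _)) (sym (Σfin≡∑ (m G) _))
  (∑-mono-≤ (λ e → *-monoˡ-≤ (incidence G e v) (subst (⟦ e ∈? S ⟧ ≤_) (sym (⟦∈⊤⟧ e)) (⟦⟧≤1 (e ∈? S)))))

cubic-size : ∀ G → Cubic G → 2 * m G ≡ 3 * n G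
cubic-size G cubic = begin
  2 * m G                    ≡⟨ cong (2 *_) (card-⊤ (m G)) ⟨
  2 * card (⊤ {m G})         ≡⟨ handshake G ⊤ ⟨
  ∑[ v < n G ] degG G v      ≡⟨ sum-cong-≗ cubic ⟩
  ∑[ v < n G ] 3             ≡⟨ ∑-const (n G) 3 ⟩
  n G * 3                    ≡⟨ *-comm (n G) 3 ⟩
  3 * n G ∎
  where open ≡-Reasoning

odd≤3 : ∀ d → d ≤ 3 → d % 2 ≡ 1 → d ≡ 1 + 2 * ⟦ d ≟ 3 ⟧
odd≤3 1 _ _ = refl
odd≤3 3 _ _ = refl
odd≤3 (suc (suc (suc (suc _)))) (s≤s (s≤s (s≤s ()))) _

join-deg : ∀ G → Cubic G → ∀ J → IsJoin G J → ∀ v → deg G J v ≡ 1 + 2 * ⟦ deg G J v ≟ 3 ⟧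
join-deg G cubic J join v = odd≤3 (deg G J v)
  (subst (deg G J v ≤_) (cubic v) (deg≤degG G J v))
  (trans (join v) (cong (_% 2) (cubic v)))

join-size : ∀ G → Cubic G → ∀ J → IsJoin G J → 2 * card J ≡ n G + 2 * nJ G J
join-size G cubic J join = begin
  2 * card J                                           ≡⟨ handshake G J ⟨
  ∑[ v < n G ] deg G J v                               ≡⟨ sum-cong-≗ (join-deg G cubic J join) ⟩
  ∑[ v < n G ] (1 + 2 * isJ v)                         ≡⟨ ∑-distrib-+ (λ _ → 1) (λ v → 2 * isJ v) ⟩
  ∑[ v < n G ] 1 + ∑[ v < n G ] (2 * isJ v)            ≡⟨ cong₂ _+_ (∑-const (n G) 1) (sym (*-distribˡ-sum 2 isJ)) ⟩
  n G * 1 + 2 * ∑[ v < n G ] isJ v                     ≡⟨ cong₂ _+_ (*-identityʳ (n G)) (cong (2 *_) (sym (Σfin≡∑ (n G) isJ))) ⟩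
  n G + 2 * nJ G J ∎
  where
  open ≡-Reasoning
  isJ : Fin (n G) → ℕ
  isJ v = ⟦ deg G J v ≟ 3 ⟧

three-joins-size : ∀ G → Cubic G → ∀ J₁ J₂ J₃ → IsJoin G J₁ → IsJoin G J₂ → IsJoin G J₃
  → card J₁ + card J₂ + card J₃ ≡ nJ G J₁ + nJ G J₂ + nJ G J₃ + m G
three-joins-size G cubic J₁ J₂ J₃ join₁ join₂ join₃ = *-cancelˡ-≡ _ _ 2 (begin
  2 * (card J₁ + card J₂ + card J₃)
    ≡⟨ distrib₃ (card J₁) (card J₂) (card J₃) ⟩
  2 * card J₁ + 2 * card J₂ + 2 * card J₃
    ≡⟨ cong₂ _+_ (cong₂ _+_ (join-size G cubic J₁ join₁) (join-size G cubic J₂ join₂))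
                 (join-size G cubic J₃ join₃) ⟩
  (n G + 2 * nJ G J₁) + (n G + 2 * nJ G J₂) + (n G + 2 * nJ G J₃)
    ≡⟨ collect (n G) (nJ G J₁) (nJ G J₂) (nJ G J₃) ⟩
  2 * (nJ G J₁ + nJ G J₂ + nJ G J₃) + 3 * n G
    ≡⟨ cong (2 * (nJ G J₁ + nJ G J₂ + nJ G J₃) +_) (cubic-size G cubic) ⟨
  2 * (nJ G J₁ + nJ G J₂ + nJ G J₃) + 2 * m G
    ≡⟨ distrib₂ (nJ G J₁ + nJ G J₂ + nJ G J₃) (m G) ⟨
  2 * (nJ G J₁ + nJ G J₂ + nJ G J₃ + m G) ∎)
  where
  open ≡-Reasoning
  distrib₃ : ∀ a b c → 2 * (a + b + c) ≡ 2 * a + 2 * b + 2 * c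
  distrib₃ = solve-∀
  collect : ∀ v a b c → (v + 2 * a) + (v + 2 * b) + (v + 2 * c) ≡ 2 * (a + b + c) + 3 * v
  collect = solve-∀
  distrib₂ : ∀ a b → 2 * (a + b) ≡ 2 * a + 2 * b
  distrib₂ = solve-∀

-- Summed over the edges, the left side counts |J₁| + |J₂| + |J₃| + |E₀| and the right side
-- |E₂| + 2|E₃| + |E|.
multiplicity-identity : ∀ k → k ≤ 3 → k + ⟦ k ≟ 0 ⟧ ≡ ⟦ k ≟ 2 ⟧ + 2 * ⟦ k ≟ 3 ⟧ + 1
multiplicity-identity 0 _ = refl
multiplicity-identity 1 _ = refl
multiplicity-identity 2 _ = refl
multiplicity-identity 3 _ = refl
multiplicity-identity (suc (suc (suc (suc _)))) (s≤s (s≤s (s≤s ())))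

edge-count : ∀ G (J₁ J₂ J₃ : Subset (m G))
  → card J₁ + card J₂ + card J₃ + cardE G J₁ J₂ J₃ 0
    ≡ cardE G J₁ J₂ J₃ 2 + 2 * cardE G J₁ J₂ J₃ 3 + m G
edge-count G J₁ J₂ J₃ = begin
  card J₁ + card J₂ + card J₃ + cardE G J₁ J₂ J₃ 0
    ≡⟨ cong₂ _+_ total-multiplicity (Σfin≡∑ (m G) (λ e → ⟦ μ e ≟ 0 ⟧)) ⟩
  ∑[ e < m G ] μ e + ∑[ e < m G ] ⟦ μ e ≟ 0 ⟧
    ≡⟨ ∑-distrib-+ μ (λ e → ⟦ μ e ≟ 0 ⟧) ⟨
  ∑[ e < m G ] (μ e + ⟦ μ e ≟ 0 ⟧)
    ≡⟨ sum-cong-≗ (λ e → multiplicity-identity (μ e) (μ≤3 e)) ⟩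
  ∑[ e < m G ] (⟦ μ e ≟ 2 ⟧ + 2 * ⟦ μ e ≟ 3 ⟧ + 1)
    ≡⟨ ∑-distrib-+ (λ e → ⟦ μ e ≟ 2 ⟧ + 2 * ⟦ μ e ≟ 3 ⟧) (λ _ → 1) ⟩
  ∑[ e < m G ] (⟦ μ e ≟ 2 ⟧ + 2 * ⟦ μ e ≟ 3 ⟧) + ∑[ e < m G ] 1
    ≡⟨ cong₂ _+_ (∑-distrib-+ (λ e → ⟦ μ e ≟ 2 ⟧) (λ e → 2 * ⟦ μ e ≟ 3 ⟧))
                 (trans (∑-const (m G) 1) (*-identityʳ (m G))) ⟩
  ∑[ e < m G ] ⟦ μ e ≟ 2 ⟧ + ∑[ e < m G ] (2 * ⟦ μ e ≟ 3 ⟧) + m G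
    ≡⟨ cong (_+ m G) (cong₂ _+_ (Σfin≡∑ (m G) (λ e → ⟦ μ e ≟ 2 ⟧))
                                (trans (cong (2 *_) (Σfin≡∑ (m G) (λ e → ⟦ μ e ≟ 3 ⟧)))
                                       (*-distribˡ-sum 2 (λ e → ⟦ μ e ≟ 3 ⟧)))) ⟨
  cardE G J₁ J₂ J₃ 2 + 2 * cardE G J₁ J₂ J₃ 3 + m G ∎
  where
  open ≡-Reasoning
  μ : Fin (m G) → ℕ
  μ = mult G J₁ J₂ J₃
  μ≤3 : ∀ e → μ e ≤ 3
  μ≤3 e = +-mono-≤ (+-mono-≤ (⟦⟧≤1 (e ∈? J₁)) (⟦⟧≤1 (e ∈? J₂))) (⟦⟧≤1 (e ∈? J₃))
  total-multiplicity : card J₁ + card J₂ + card J₃ ≡ ∑[ e < m G ] μ e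
  total-multiplicity = sym (trans (∑-distrib-+ (λ e → ⟦ e ∈? J₁ ⟧ + ⟦ e ∈? J₂ ⟧) (λ e → ⟦ e ∈? J₃ ⟧))
                                 (cong (_+ card J₃) (∑-distrib-+ (λ e → ⟦ e ∈? J₁ ⟧) (λ e → ⟦ e ∈? J₂ ⟧))))

proposition2p1 : (G : Graph) → Cubic G → (J₁ J₂ J₃ : Subset (m G))
    → IsJoin G J₁ → IsJoin G J₂ → IsJoin G J₃
    → cardE G J₁ J₂ J₃ 0 + (nJ G J₁ + nJ G J₂ + nJ G J₃)
      ≡ cardE G J₁ J₂ J₃ 2 + 2 * cardE G J₁ J₂ J₃ 3
proposition2p1 G cubic J₁ J₂ J₃ join₁ join₂ join₃ = +-cancelʳ-≡ (m G) _ _ (begin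
  E₀ + (nJ G J₁ + nJ G J₂ + nJ G J₃) + m G   ≡⟨ +-assoc E₀ _ (m G) ⟩
  E₀ + (nJ G J₁ + nJ G J₂ + nJ G J₃ + m G)   ≡⟨ cong (E₀ +_) (three-joins-size G cubic J₁ J₂ J₃ join₁ join₂ join₃) ⟨
  E₀ + (card J₁ + card J₂ + card J₃)         ≡⟨ +-comm E₀ _ ⟩
  card J₁ + card J₂ + card J₃ + E₀           ≡⟨ edge-count G J₁ J₂ J₃ ⟩
  cardE G J₁ J₂ J₃ 2 + 2 * cardE G J₁ J₂ J₃ 3 + m G ∎)
  where
  open ≡-Reasoning
  E₀ : ℕ
  E₀ = cardE G J₁ J₂ J₃ 0
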